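{- Let $t<d-1$. Any monomial whose support contains variables from $t$ distinct non-compact rows survives $R_\epsilon$ with probability at most $1/n^{\epsilon t}$.
   Context: Let $n=2^k$, $\mathbb{F}_n=\mathbb{F}_{2^k}$ with elements identified with $[n]$; variables $x_{i,j}$, $i,j\in[n]$, arranged in an $n\times n$ variable matrix whose $i$-th row is $\{x_{i,j}:j\in[n]\}$. Fix an $\mathbb{F}_2$-linear isomorphism $\phi:\mathbb{F}_{2^k}\to\mathbb{F}_2^k$, $[a]=\phi(a)$; for $f=\sum_{i<d}a_iZ^i$, $[f]\in\mathbb{F}_2^{kd}$ concatenates $[a_0],\dots,[a_{d-1}]$. For $i\in\mathbb{F}_n$, $\mathsf{Eval}_i$ is the $dk\times k$ matrix with $[f(i)]=[f]\cdot\mathsf{Eval}_i$, and $\overline{\mathsf{Eval}_i}$ is the $dk\times 2^k$ matrix of all $\mathbb{F}_2$-linear combinations of columns of $\mathsf{Eval}_i$. Procedure $R_\epsilon$ ($\epsilon k$ an integer): start with empty matrix $\mathcal{M}$ and empty vector $\mathcal{B}$; for $i=1,\dots,n$, repeat $\epsilon k$ times: if all columns of $\overline{\mathsf{Eval}_i}$ lie in the column span of $\mathcal{M}$ do nothing, else pick a uniformly random column of $\overline{\mathsf{Eval}_i}$ outside that span and a uniformly random $b\in\mathbb{F}_2$ and append them to $\mathcal{M}$ and $\mathcal{B}$; then set $A_i=\{v\in\mathbb{F}_2^{kd}:v\mathcal{M}=\mathcal{B}\}$. Output $S_0=\{x_{i,j}:j\neq f(i)\ \forall f\text{ with }[f]\in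 A_n\}$. A monomial survives if none of its variables is in $S_0$. Row $i$ is compact if the columns of the final $\mathcal{M}$ span every column of $\mathsf{Eval}_i$, and non-compact otherwise. -}

module Defs where

import Data.Bool
open import Data.Bool using (Bool; true; false; _xor_; _∧_; not; if_then_else_)
open import Data.Bool.Properties using () renaming (_≟_ to _≟𝔹_)
open import Data.Nat using (ℕ; zero; suc; _*_; _^_)
open import Data.Fin using (Fin)
open import Data.Vec as V using (Vec; []; _∷_)
open import Data.Vec.Properties using (≡-dec)
open import Data.List as L using (List; []; _∷_; _++_; [_])
open import Data.Product using (_×_; _,_; proj₁; proj₂)
open import Data.Integer using (+_)
open import Data.Rational as Q using (ℚ; 0ℚ; 1ℚ)
open import Relation.Nullary using (¬_; does)
open import Relation.Binary.PropositionalEquality using (_≡_)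
open import Algebra.Structures using (IsCommutativeRing)

Vec₂ : ℕ → Set
Vec₂ m = Vec Bool m

𝟘 : ∀ {m} → Vec₂ m
𝟘 = V.replicate _ false

_⊕_ : ∀ {m} → Vec₂ m → Vec₂ m → Vec₂ m
_⊕_ = V.zipWith _xor_

dot : ∀ {m} → Vec₂ m → Vec₂ m → Bool
dot u v = V.foldr _ _xor_ false (V.zipWith _∧_ u v)

_=ᵇ_ : ∀ {m} → Vec₂ m → Vec₂ m → Bool
u =ᵇ v = does (≡-dec _≟𝔹_ u v)

anyᵇ : ∀ {A : Set} → (A → Bool) → List A → Bool
anyᵇ p = L.foldr (λ x r → Data.Bool._∨_ (p x) r) false

allᵇ : ∀ {A : Set} → (A → Bool) → List A → Bool
allᵇ p = L.foldr (λ x r → p x ∧ r) true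

allVecs : (m : ℕ) → List (Vec₂ m)
allVecs zero    = [ [] ]
allVecs (suc m) = L.map (false ∷_) (allVecs m) ++ L.map (true ∷_) (allVecs m)

unit : ∀ {m} → Fin m → Vec₂ m
unit b = V.updateAt (V.replicate _ false) b (λ _ → true)

spanList : ∀ {m} → List (Vec₂ m) → List (Vec₂ m)
spanList []       = [ 𝟘 ]
spanList (u ∷ us) = spanList us ++ L.map (u ⊕_) (spanList us)

inSpan : ∀ {m} → Vec₂ m → List (Vec₂ m) → Bool
inSpan v us = anyᵇ (v =ᵇ_) (spanList us)

-- Via the F₂-linear isomorphism φ we identify the
-- field with F₂^k: addition is coordinatewise xor (φ is additive), and a
-- field structure is a multiplication making it a field.  Quantifying over
-- all such structures is the same as quantifying over φ.

record F2kField (k : ℕ) : Set where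
  field
    _·_    : Vec₂ k → Vec₂ k → Vec₂ k
    one    : Vec₂ k
    inv    : Vec₂ k → Vec₂ k
    isCommutativeRing : IsCommutativeRing _≡_ _⊕_ _·_ (λ x → x) 𝟘 one
    one≢zero : ¬ (one ≡ 𝟘)
    inverse  : ∀ x → ¬ (x ≡ 𝟘) → x · inv x ≡ one

module Construction {k : ℕ} (𝔽 : F2kField k) (d : ℕ) where
  open F2kField 𝔽

  F : Set
  F = Vec₂ k

  pow : F → ℕ → F
  pow x zero    = one
  pow x (suc m) = x · pow x m

  -- polynomials of degree < d: coefficient vectors (a₀ , … , a_{d-1})
  Poly : Set
  Poly = Vec F d

  eval : Poly → F → F
  eval f x = V.foldr _ _⊕_ 𝟘 (V.zipWith _·_ f (V.tabulate (λ m → pow x (Data.Fin.toℕ m))))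

  -- [f] ∈ F₂^{kd}: concatenation of [a₀], …, [a_{d-1}]
  ⟦_⟧ : Poly → Vec₂ (d * k)
  ⟦ f ⟧ = V.concat f

  allPolys : List Poly
  allPolys = go d
    where
    go : (m : ℕ) → List (Vec F m)
    go zero    = [ [] ]
    go (suc m) = L.concatMap (λ a → L.map (a ∷_) (go m)) (allVecs k)

  -- Eval_i as a (dk × k) matrix, given by its rows: the row indexed by
  -- (m , b) is [e_b · i^m], so that [f] · Eval_i = [f(i)].
  EvalRows : F → Vec (Vec₂ k) (d * k)
  EvalRows i = V.concat (V.tabulate {n = d} λ m → V.tabulate λ b → unit b · pow i (Data.Fin.toℕ m))

  Eval·_ : F → Vec₂ k → Vec₂ (d * k)
  (Eval· i) c = V.map (λ r → dot r c) (EvalRows i)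

  EvalCols : F → List (Vec₂ (d * k))
  EvalCols i = L.map (λ b → (Eval· i) (unit b)) (L.allFin k)

  -- the 2^k columns of \overline{Eval_i}: all F₂-linear combinations of
  -- the columns of Eval_i (the combination with coefficient vector c)
  EvalBarCols : F → List (Vec₂ (d * k))
  EvalBarCols i = L.map (Eval· i) (allVecs k)

  -- State of R_ε: the list of (column of 𝓜 , corresponding entry of 𝓑)

  State : Set
  State = List (Vec₂ (d * k) × Bool)

  colsOf : State → List (Vec₂ (d * k))
  colsOf = L.map proj₁

  -- one iteration of the inner loop for row i; the result is the list of
  -- equally likely successor states (uniform column outside the span,
  -- times uniform bit b)
  step : F → State → List State
  step i s with L.filterᵇ (λ c → not (inSpan c (colsOf s))) (EvalBarCols i)
  ... | []    = [ s ]
  ... | cands = L.concatMap (λ c → (s ++ [ (c , false) ]) ∷ (s ++ [ (c , true) ]) ∷ []) cands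

  -- the whole procedure: rows in the given order, εk steps each
  steps : List F → ℕ → List (State → List State)
  steps order e = L.concatMap (λ i → L.replicate e (step i)) order

  -- v ∈ A  iff  v 𝓜 = 𝓑
  satisfies : Vec₂ (d * k) → State → Bool
  satisfies v s = allᵇ (λ { (u , b) → does (dot v u ≟𝔹 b) }) s

  -- x_{i,j} ∉ S₀  iff  j = f(i) for some f with [f] ∈ A_n
  notInS₀ : State → F × F → Bool
  notInS₀ s (i , j) = anyᵇ (λ f → satisfies ⟦ f ⟧ s ∧ (eval f i =ᵇ j)) allPolys

  -- a monomial (given by the list of its variables x_{i,j}, as pairs (i,j))
  -- survives iff none of its variables lies in S₀
  survives : List (F × F) → State → Bool
  survives mono s = allᵇ (notInS₀ s) mono

  compact : F → State → Bool
  compact i s = allᵇ (λ col → inSpan col (colsOf s)) (EvalCols i)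

  #nonCompactRows : List (F × F) → State → ℕ
  #nonCompactRows mono s =
    L.length (L.filterᵇ (λ i → not (compact i s)) (L.deduplicate (≡-dec _≟𝔹_) (L.map proj₁ mono)))

-- Probability of an event (a Bool-valued predicate on final states) after
-- running a sequence of random steps, each step producing a list of
-- equally likely successor states.

average : List ℚ → ℚ
average []       = 0ℚ
average (x ∷ xs) = L.foldr Q._+_ 0ℚ (x ∷ xs) Q.* ((+ 1) Q./ suc (L.length xs))

prob : ∀ {S : Set} → List (S → List S) → (S → Bool) → S → ℚ
prob []         E s = if E s then 1ℚ else 0ℚ
prob (st ∷ sts) E s = average (L.map (prob sts E) (st s))

half^ : ℕ → ℚ
half^ zero    = 1ℚ
half^ (suc m) = ((+ 1) Q./ 2) Q.* half^ m

-- Run R_ε and look at a row i carrying a variable x_{i,j} of the monomial. Each of the εk steps of row i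
-- that finds a column Eval_i w outside the current span appends it with a uniform bit b, and since
-- [f] · Eval_i w = ⟨f(i) , w⟩, a polynomial f with [f] ∈ A_n and f(i) = j can survive only if b = ⟨j , w⟩:
-- the step halves the probability of staying consistent with the monomial. A step finding no such
-- column means row i is already compact, and compactness persists. Going through the rows from the
-- last to the first, the indicator of "consistent and at least t non-compact rows" is therefore bounded
-- in expectation by 2^{-εk·(number of non-compact rows of the monomial)} on the event "at least t
-- non-compact rows", which is at most 2^{-εk t} there.

module Submission where

open import Defs
open import Algebra.Bundles using (CommutativeRing)
open import Algebra.Structures using (IsCommutativeRing)
open import Data.Bool using (Bool; true; false; _xor_; _∧_; _∨_; not; if_then_else_; T)
open import Data.Bool.Properties
  using (T?; xor-assoc; xor-∧-commutativeRing; ∧-distribʳ-xor; ∧-zeroʳ; ∧-conicalˡ; ∧-conicalʳ)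
  renaming (_≟_ to _≟𝔹_)
open import Data.Fin using (Fin; toℕ)
open import Data.Integer using (+≤+)
open import Data.List as L using (List; []; _∷_; _++_; [_]; map; filterᵇ; length; allFin)
open import Data.List.Properties using (map-cong; length-map; map-++)
open import Data.List.Membership.Propositional using (_∈_)
open import Data.List.Membership.Propositional.Properties
  using (∈-filter⁺; ∈-filter⁻; ∈-map⁺; ∈-map⁻; ∈-++⁺ˡ; ∈-++⁺ʳ; ∈-++⁻; ∈-allFin)
open import Data.List.Relation.Unary.Any using (here; there)
import Data.List.Relation.Unary.Any.Properties as Any
open import Data.List.Relation.Unary.All as All using (All; []; _∷_)
open import Data.List.Relation.Unary.All.Properties using (replicate⁺; concat⁺; map⁺)
open import Data.List.Relation.Unary.AllPairs using ([]; _∷_)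
open import Data.List.Relation.Unary.Unique.Propositional using (Unique)
open import Data.List.Relation.Unary.Unique.DecPropositional.Properties using (deduplicate-!)
open import Data.Nat as ℕ using (ℕ; zero; suc; z≤n; s≤s; _<_; _∸_; _^_; _≤ᵇ_)
import Data.Nat.Properties as ℕ
open import Data.Product using (_×_; _,_; proj₁; ∃-syntax)
open import Data.Rational as ℚ using (ℚ; 0ℚ; 1ℚ; ½; _≤_; _*_; _+_)
import Data.Rational
import Data.Rational.Properties as ℚ
open import Data.Sum using (_⊎_; inj₁; inj₂)
open import Data.Unit using (tt)
open import Data.Vec as V using (Vec; []; _∷_)
open import Data.Vec.Properties using (≡-dec; tabulate-∘)
import Data.Vec.Properties as Vecₚ
open import Function using (_∘_; case_of_)
open import Function.Bundles using (_↔_; Inverse)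
open import Relation.Binary.PropositionalEquality hiding ([_])
open import Relation.Nullary using (Dec; yes; does; contradiction)
open import Relation.Nullary.Decidable using (dec-true; dec-false)

open import Algebra.Properties.CommutativeSemigroup
  (CommutativeRing.+-commutativeSemigroup xor-∧-commutativeRing) using (interchange)

module _ {A : Set} (p : A → Bool) where

  anyᵇ-witness : ∀ xs → anyᵇ p xs ≡ true → ∃[ x ] x ∈ xs × p x ≡ true
  anyᵇ-witness (x ∷ xs) any with p x in px
  ... | true  = x , here refl , px
  ... | false with anyᵇ-witness xs any
  ...   | y , y∈xs , py = y , there y∈xs , py

  anyᵇ-intro : ∀ {xs x} → x ∈ xs → p x ≡ true → anyᵇ p xs ≡ true
  anyᵇ-intro {x ∷ _} (here refl) px rewrite px = refl
  anyᵇ-intro {y ∷ _} (there x∈xs) px with p y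
  ... | true  = refl
  ... | false = anyᵇ-intro x∈xs px

  allᵇ-elim : ∀ {xs x} → allᵇ p xs ≡ true → x ∈ xs → p x ≡ true
  allᵇ-elim {y ∷ _} all x∈xs with p y in py
  allᵇ-elim {y ∷ _} all (here refl)  | true = py
  allᵇ-elim {y ∷ _} all (there x∈xs) | true = allᵇ-elim all x∈xs

  allᵇ-intro : ∀ xs → (∀ {x} → x ∈ xs → p x ≡ true) → allᵇ p xs ≡ true
  allᵇ-intro []       _   = refl
  allᵇ-intro (x ∷ xs) all rewrite all (here refl) = allᵇ-intro xs (all ∘ there)

  allᵇ-++ : ∀ xs ys → allᵇ p (xs ++ ys) ≡ allᵇ p xs ∧ allᵇ p ys
  allᵇ-++ []       ys = refl
  allᵇ-++ (x ∷ xs) ys with p x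
  ... | true  = allᵇ-++ xs ys
  ... | false = refl

witness : ∀ {P : Set} (p? : Dec P) → does p? ≡ true → P
witness (yes p) _ = p

=ᵇ-refl : ∀ {m} (u : Vec₂ m) → (u =ᵇ u) ≡ true
=ᵇ-refl u = dec-true (≡-dec _≟𝔹_ u u) refl

memb : ∀ {m} → Vec₂ m → List (Vec₂ m) → Bool
memb x = anyᵇ (x =ᵇ_)

memb⁺ : ∀ {m} {x : Vec₂ m} {xs} → x ∈ xs → memb x xs ≡ true
memb⁺ {x = x} x∈xs = anyᵇ-intro (x =ᵇ_) x∈xs (=ᵇ-refl x)

memb⁻ : ∀ {m} {x : Vec₂ m} {xs} → memb x xs ≡ true → x ∈ xs
memb⁻ {x = x} {xs} x∈ᵇxs with anyᵇ-witness (x =ᵇ_) xs x∈ᵇxs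
... | y , y∈xs , x=ᵇy rewrite witness (≡-dec _≟𝔹_ x y) x=ᵇy = y∈xs

filterᵇ-≡[] : ∀ {A : Set} (p : A → Bool) {xs x} → filterᵇ p xs ≡ [] → x ∈ xs → p x ≡ false
filterᵇ-≡[] p {x = x} none x∈xs with p x in px
... | false = refl
... | true  = case subst (x ∈_) none (∈-filter⁺ (T? ∘ p) x∈xs (subst T (sym px) tt)) of λ ()

filterᵇ-cong : ∀ {A : Set} {p q : A → Bool} xs → (∀ {x} → x ∈ xs → p x ≡ q x) →
               filterᵇ p xs ≡ filterᵇ q xs
filterᵇ-cong             []       _  = refl
filterᵇ-cong {p = p} {q} (x ∷ xs) eq with p x | q x | eq (here refl)
... | true  | .true  | refl = cong (x ∷_) (filterᵇ-cong xs (eq ∘ there))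
... | false | .false | refl = filterᵇ-cong xs (eq ∘ there)

length-filterᵇ-≤-suc : ∀ {A : Set} (p q : A → Bool) (a : A) {xs} → Unique xs →
  (∀ x → x ≢ a → p x ≡ q x) → length (filterᵇ p xs) ℕ.≤ suc (length (filterᵇ q xs))
length-filterᵇ-≤-suc p q a []              _ = z≤n
length-filterᵇ-≤-suc p q a {y ∷ ys} (y∉ys ∷ !ys) p≡q
  with p y in py | q y in qy
... | true  | true  = s≤s (length-filterᵇ-≤-suc p q a !ys p≡q)
... | false | false = length-filterᵇ-≤-suc p q a !ys p≡q
... | false | true  = ℕ.m≤n⇒m≤1+n (length-filterᵇ-≤-suc p q a !ys p≡q)
... | true  | false = s≤s (ℕ.≤-reflexive (cong length (filterᵇ-cong ys (λ {x} x∈ys → p≡q x (x≢a x∈ys)))))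
  where
  x≢a : ∀ {x} → x ∈ ys → x ≢ a
  x≢a x∈ys refl = contradiction (trans (sym py) (trans (p≡q y (All.lookup y∉ys x∈ys)) qy)) λ ()

dot-++ : ∀ {m n} (u v : Vec₂ m) (u′ v′ : Vec₂ n) →
         dot (u V.++ u′) (v V.++ v′) ≡ dot u v xor dot u′ v′
dot-++ []      []      u′ v′ = refl
dot-++ (a ∷ u) (x ∷ v) u′ v′ = begin
  (a ∧ x) xor dot (u V.++ u′) (v V.++ v′) ≡⟨ cong ((a ∧ x) xor_) (dot-++ u v u′ v′) ⟩
  (a ∧ x) xor (dot u v xor dot u′ v′)     ≡⟨ xor-assoc (a ∧ x) _ _ ⟨
  ((a ∧ x) xor dot u v) xor dot u′ v′     ∎
  where open ≡-Reasoning

dot-⊕ˡ : ∀ {m} (u v w : Vec₂ m) → dot (u ⊕ v) w ≡ dot u w xor dot v w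
dot-⊕ˡ []      []      []      = refl
dot-⊕ˡ (a ∷ u) (b ∷ v) (c ∷ w) = begin
  ((a xor b) ∧ c) xor dot (u ⊕ v) w                 ≡⟨ cong₂ _xor_ (∧-distribʳ-xor c a b) (dot-⊕ˡ u v w) ⟩
  ((a ∧ c) xor (b ∧ c)) xor (dot u w xor dot v w)   ≡⟨ interchange (a ∧ c) (b ∧ c) _ _ ⟩
  ((a ∧ c) xor dot u w) xor ((b ∧ c) xor dot v w)   ∎
  where open ≡-Reasoning

dot-𝟘ˡ : ∀ {m} (w : Vec₂ m) → dot 𝟘 w ≡ false
dot-𝟘ˡ []      = refl
dot-𝟘ˡ (x ∷ w) = dot-𝟘ˡ w

⊕-identityˡ : ∀ {m} (a : Vec₂ m) → 𝟘 ⊕ a ≡ a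
⊕-identityˡ []      = refl
⊕-identityˡ (x ∷ a) = cong (x ∷_) (⊕-identityˡ a)

lincomb : ∀ {m n} → Vec₂ m → Vec (Vec₂ n) m → Vec₂ n
lincomb []          []       = 𝟘
lincomb (true ∷ a)  (r ∷ rs) = r ⊕ lincomb a rs
lincomb (false ∷ a) (r ∷ rs) = lincomb a rs

dot-lincomb : ∀ {m n} (a : Vec₂ m) (rs : Vec (Vec₂ n) m) (w : Vec₂ n) →
              dot a (V.map (λ r → dot r w) rs) ≡ dot (lincomb a rs) w
dot-lincomb []          []       w = sym (dot-𝟘ˡ w)
dot-lincomb (true ∷ a)  (r ∷ rs) w =
  trans (cong (dot r w xor_) (dot-lincomb a rs w)) (sym (dot-⊕ˡ r (lincomb a rs) w))
dot-lincomb (false ∷ a) (r ∷ rs) w = dot-lincomb a rs w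

lincomb-false∷ : ∀ {m n} (a : Vec₂ m) (us : Vec (Vec₂ n) m) →
                 lincomb a (V.map (false ∷_) us) ≡ false ∷ lincomb a us
lincomb-false∷ []          []       = refl
lincomb-false∷ (true ∷ a)  (u ∷ us) = cong ((false ∷ u) ⊕_) (lincomb-false∷ a us)
lincomb-false∷ (false ∷ a) (u ∷ us) = lincomb-false∷ a us

lincomb-unit : ∀ {m} (a : Vec₂ m) → lincomb a (V.tabulate unit) ≡ a
lincomb-unit []          = refl
lincomb-unit (true ∷ a)  = begin
  (true ∷ 𝟘) ⊕ lincomb a (V.tabulate (λ b → false ∷ unit b))
    ≡⟨ cong (λ us → (true ∷ 𝟘) ⊕ lincomb a us) (tabulate-∘ (false ∷_) unit) ⟩
  (true ∷ 𝟘) ⊕ lincomb a (V.map (false ∷_) (V.tabulate unit))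
    ≡⟨ cong ((true ∷ 𝟘) ⊕_) (lincomb-false∷ a _) ⟩
  true ∷ (𝟘 ⊕ lincomb a (V.tabulate unit))
    ≡⟨ cong (true ∷_) (trans (⊕-identityˡ _) (lincomb-unit a)) ⟩
  true ∷ a
    ∎
  where open ≡-Reasoning
lincomb-unit (false ∷ a) = begin
  lincomb a (V.tabulate (λ b → false ∷ unit b))  ≡⟨ cong (lincomb a) (tabulate-∘ (false ∷_) unit) ⟩
  lincomb a (V.map (false ∷_) (V.tabulate unit)) ≡⟨ lincomb-false∷ a _ ⟩
  false ∷ lincomb a (V.tabulate unit)            ≡⟨ cong (false ∷_) (lincomb-unit a) ⟩
  false ∷ a                                      ∎
  where open ≡-Reasoning

module Evaluation {k : ℕ} (𝔽 : F2kField k) (d : ℕ) where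
  open F2kField 𝔽
  open Construction 𝔽 d
  open IsCommutativeRing isCommutativeRing using (distribʳ; zeroˡ)
  open ≡-Reasoning

  lincomb-·ʳ : ∀ {m} (a : Vec₂ m) (us : Vec F m) (p : F) →
               lincomb a (V.map (_· p) us) ≡ lincomb a us · p
  lincomb-·ʳ []          []       p = sym (zeroˡ p)
  lincomb-·ʳ (true ∷ a)  (u ∷ us) p =
    trans (cong ((u · p) ⊕_) (lincomb-·ʳ a us p)) (sym (distribʳ p u (lincomb a us)))
  lincomb-·ʳ (false ∷ a) (u ∷ us) p = lincomb-·ʳ a us p

  -- rows of the matrix of x ↦ x · p; Eval_i stacks these for p = i⁰, …, i^{d-1}
  mulRows : F → Vec F k
  mulRows p = V.tabulate (λ b → unit b · p)

  dot-mulRows : ∀ (a p w : F) → dot a (V.map (λ r → dot r w) (mulRows p)) ≡ dot (a · p) w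
  dot-mulRows a p w = begin
    dot a (V.map (λ r → dot r w) (mulRows p)) ≡⟨ dot-lincomb a (mulRows p) w ⟩
    dot (lincomb a (mulRows p)) w             ≡⟨ cong (λ r → dot (lincomb a r) w) (tabulate-∘ (_· p) unit) ⟩
    dot (lincomb a (V.map (_· p) (V.tabulate unit))) w ≡⟨ cong (λ r → dot r w) (lincomb-·ʳ a _ p) ⟩
    dot (lincomb a (V.tabulate unit) · p) w   ≡⟨ cong (λ r → dot (r · p) w) (lincomb-unit a) ⟩
    dot (a · p) w                             ∎

  dot-concat-mulRows : ∀ {n} (f ps : Vec F n) (w : F) →
    dot (V.concat f) (V.map (λ r → dot r w) (V.concat (V.map mulRows ps)))
      ≡ dot (V.foldr _ _⊕_ 𝟘 (V.zipWith _·_ f ps)) w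
  dot-concat-mulRows []      []       w = sym (dot-𝟘ˡ w)
  dot-concat-mulRows (a ∷ f) (p ∷ ps) w = begin
    dot (a V.++ V.concat f) (col (mulRows p V.++ rows))      ≡⟨ cong (dot (a V.++ V.concat f)) (Vecₚ.map-++ _ (mulRows p) rows) ⟩
    dot (a V.++ V.concat f) (col (mulRows p) V.++ col rows)  ≡⟨ dot-++ a _ (V.concat f) _ ⟩
    dot a (col (mulRows p)) xor dot (V.concat f) (col rows)  ≡⟨ cong₂ _xor_ (dot-mulRows a p w) (dot-concat-mulRows f ps w) ⟩
    dot (a · p) w xor dot Σ w                                ≡⟨ dot-⊕ˡ (a · p) Σ w ⟨
    dot ((a · p) ⊕ Σ) w                                      ∎
    where
    col : ∀ {n} → Vec F n → Vec Bool n
    col = V.map (λ r → dot r w)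
    rows = V.concat (V.map mulRows ps)
    Σ = V.foldr _ _⊕_ 𝟘 (V.zipWith _·_ f ps)

  -- [f] · Eval_i = [f(i)], tested against every column vector w
  dot-⟦⟧-Eval : ∀ (f : Poly) (i w : F) → dot ⟦ f ⟧ ((Eval· i) w) ≡ dot (eval f i) w
  dot-⟦⟧-Eval f i w = trans
    (cong (λ (rows : Vec (Vec F k) d) → dot ⟦ f ⟧ (V.map (λ r → dot r w) (V.concat rows)))
          (tabulate-∘ mulRows (λ m → pow i (toℕ m))))
    (dot-concat-mulRows f (V.tabulate (λ m → pow i (toℕ m))) w)

*-monoˡ-≤ : ∀ {r p q} → 0ℚ ≤ r → p ≤ q → r * p ≤ r * q
*-monoˡ-≤ {r} 0≤r = ℚ.*-monoˡ-≤-nonNeg r {{ℚ.nonNegative 0≤r}}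

*-monoʳ-≤ : ∀ {r p q} → 0ℚ ≤ r → p ≤ q → p * r ≤ q * r
*-monoʳ-≤ {r} 0≤r = ℚ.*-monoʳ-≤-nonNeg r {{ℚ.nonNegative 0≤r}}

0≤* : ∀ {p q} → 0ℚ ≤ p → 0ℚ ≤ q → 0ℚ ≤ p * q
0≤* {p} 0≤p 0≤q = ℚ.≤-trans (ℚ.≤-reflexive (sym (ℚ.*-zeroʳ p))) (*-monoˡ-≤ 0≤p 0≤q)

0≤1 : 0ℚ ≤ 1ℚ
0≤1 = ℚ.*≤* (+≤+ z≤n)

𝟙 : Bool → ℚ
𝟙 b = if b then 1ℚ else 0ℚ

𝟙-nonneg : ∀ b → 0ℚ ≤ 𝟙 b
𝟙-nonneg true  = 0≤1
𝟙-nonneg false = ℚ.≤-refl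

𝟙-mono : ∀ {a b} → (a ≡ true → b ≡ true) → 𝟙 a ≤ 𝟙 b
𝟙-mono {false} _   = 𝟙-nonneg _
𝟙-mono {true}  a⇒b rewrite a⇒b refl = ℚ.≤-refl

sumℚ : List ℚ → ℚ
sumℚ = L.foldr _+_ 0ℚ

module _ {S : Set} where

  sum-mono : ∀ (xs : List S) {X Y : S → ℚ} → (∀ {x} → x ∈ xs → X x ≤ Y x) →
             sumℚ (map X xs) ≤ sumℚ (map Y xs)
  sum-mono []       X≤Y = ℚ.≤-refl
  sum-mono (x ∷ xs) X≤Y = ℚ.+-mono-≤ (X≤Y (here refl)) (sum-mono xs (X≤Y ∘ there))

  sum-*ˡ : ∀ (xs : List S) (X : S → ℚ) r → sumℚ (map (λ x → r * X x) xs) ≡ r * sumℚ (map X xs)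
  sum-*ˡ []       X r = sym (ℚ.*-zeroʳ r)
  sum-*ˡ (x ∷ xs) X r = trans (cong (λ z → r * X x + z) (sum-*ˡ xs X r)) (sym (ℚ.*-distribˡ-+ r (X x) _))

  average-≤ : ∀ (xs : List S) {X Y : S → ℚ} r → 0ℚ ≤ r →
              r * sumℚ (map X xs) ≤ sumℚ (map Y xs) → r * average (map X xs) ≤ average (map Y xs)
  average-≤ []           r _   _ = ℚ.≤-reflexive (ℚ.*-zeroʳ r)
  average-≤ (x ∷ xs) {X} {Y} r 0≤r rX≤Y rewrite length-map X xs | length-map Y xs =
    ℚ.≤-trans (ℚ.≤-reflexive (sym (ℚ.*-assoc r _ _)))
              (*-monoʳ-≤ (ℚ.nonNegative⁻¹ _ {{ℚ.normalize-nonNeg 1 (suc (length xs))}}) rX≤Y)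

  average-mono : ∀ (xs : List S) {X Y : S → ℚ} → (∀ {x} → x ∈ xs → X x ≤ Y x) →
                 average (map X xs) ≤ average (map Y xs)
  average-mono xs X≤Y =
    ℚ.≤-trans (ℚ.≤-reflexive (sym (ℚ.*-identityˡ _)))
      (average-≤ xs 1ℚ 0≤1 (ℚ.≤-trans (ℚ.≤-reflexive (ℚ.*-identityˡ _)) (sum-mono xs X≤Y)))

  average-*ˡ : ∀ (xs : List S) (X : S → ℚ) r → average (map (λ x → r * X x) xs) ≡ r * average (map X xs)
  average-*ˡ []       X r = sym (ℚ.*-zeroʳ r)
  average-*ˡ (x ∷ xs) X r rewrite length-map (λ x → r * X x) xs | length-map X xs =
    trans (cong (_* _) (sum-*ˡ (x ∷ xs) X r)) (ℚ.*-assoc r _ _)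

average-[_] : ∀ x → average [ x ] ≡ x
average-[ x ] = trans (ℚ.*-identityʳ (x + 0ℚ)) (ℚ.+-identityʳ x)

module _ {S : Set} where

  𝔼 : List (S → List S) → (S → ℚ) → S → ℚ
  𝔼 []         f s = f s
  𝔼 (st ∷ sts) f s = average (map (𝔼 sts f) (st s))

  prob≡𝔼 : ∀ sts (B : S → Bool) s → prob sts B s ≡ 𝔼 sts (𝟙 ∘ B) s
  prob≡𝔼 []         B s = refl
  prob≡𝔼 (st ∷ sts) B s = cong average (map-cong (prob≡𝔼 sts B) (st s))

  𝔼-++ : ∀ sts sts′ f s → 𝔼 (sts ++ sts′) f s ≡ 𝔼 sts (𝔼 sts′ f) s
  𝔼-++ []         sts′ f s = refl
  𝔼-++ (st ∷ sts) sts′ f s = cong average (map-cong (𝔼-++ sts sts′ f) (st s))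

  Invariant : (S → Set) → (S → List S) → Set
  Invariant P st = ∀ {s s′} → P s → s′ ∈ st s → P s′

  𝔼-mono-on : (P : S → Set) → ∀ sts → All (Invariant P) sts → ∀ {f g} →
              (∀ {s} → P s → f s ≤ g s) → ∀ {s} → P s → 𝔼 sts f s ≤ 𝔼 sts g s
  𝔼-mono-on P []         []             f≤g Ps = f≤g Ps
  𝔼-mono-on P (st ∷ sts) (inv ∷ invs) f≤g Ps =
    average-mono (st _) λ s′∈ → 𝔼-mono-on P sts invs f≤g (inv Ps s′∈)

  𝔼-mono : ∀ sts {f g} → (∀ s → f s ≤ g s) → ∀ s → 𝔼 sts f s ≤ 𝔼 sts g s
  𝔼-mono []         f≤g s = f≤g s
  𝔼-mono (st ∷ sts) f≤g s = average-mono (st s) λ {s′} _ → 𝔼-mono sts f≤g s′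

  𝔼-*ˡ : ∀ sts f r s → 𝔼 sts (λ s → r * f s) s ≡ r * 𝔼 sts f s
  𝔼-*ˡ []         f r s = refl
  𝔼-*ˡ (st ∷ sts) f r s =
    trans (cong average (map-cong (λ s′ → 𝔼-*ˡ sts f r s′) (st s))) (average-*ˡ (st s) (𝔼 sts f) r)

  𝔼-0 : ∀ sts s → 𝔼 sts (λ _ → 0ℚ) s ≡ 0ℚ
  𝔼-0 sts s = begin
    𝔼 sts (λ _ → 0ℚ) s        ≡⟨ 𝔼-cong sts (λ _ → sym (ℚ.*-zeroˡ 0ℚ)) s ⟩
    𝔼 sts (λ _ → 0ℚ * 0ℚ) s   ≡⟨ 𝔼-*ˡ sts (λ _ → 0ℚ) 0ℚ s ⟩
    0ℚ * 𝔼 sts (λ _ → 0ℚ) s   ≡⟨ ℚ.*-zeroˡ (𝔼 sts (λ _ → 0ℚ) s) ⟩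
    0ℚ                        ∎
    where
    open ≡-Reasoning
    𝔼-cong : ∀ sts {f g} → (∀ s → f s ≡ g s) → ∀ s → 𝔼 sts f s ≡ 𝔼 sts g s
    𝔼-cong []         f≡g s = f≡g s
    𝔼-cong (st ∷ sts) f≡g s = cong average (map-cong (𝔼-cong sts f≡g) (st s))

  𝔼-nonneg : ∀ sts {f} → (∀ s → 0ℚ ≤ f s) → ∀ s → 0ℚ ≤ 𝔼 sts f s
  𝔼-nonneg sts {f} 0≤f s = ℚ.≤-trans (ℚ.≤-reflexive (sym (𝔼-0 sts s))) (𝔼-mono sts 0≤f s)

0≤½ : 0ℚ ≤ ½
0≤½ = ℚ.*≤* (+≤+ z≤n)

½≤1 : ½ ≤ 1ℚ
½≤1 = ℚ.*≤* (+≤+ (s≤s z≤n))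

half^-nonneg : ∀ p → 0ℚ ≤ half^ p
half^-nonneg zero    = 0≤1
half^-nonneg (suc p) = 0≤* 0≤½ (half^-nonneg p)

half^-+ : ∀ a b → half^ (a ℕ.+ b) ≡ half^ a * half^ b
half^-+ zero    b = sym (ℚ.*-identityˡ _)
half^-+ (suc a) b = trans (cong (½ *_) (half^-+ a b)) (sym (ℚ.*-assoc ½ (half^ a) (half^ b)))

half^-≤-1 : ∀ p → half^ p ≤ 1ℚ
half^-≤-1 zero    = ℚ.≤-refl
half^-≤-1 (suc p) = begin
  ½ * half^ p ≤⟨ *-monoˡ-≤ 0≤½ (half^-≤-1 p) ⟩
  ½ * 1ℚ      ≡⟨ ℚ.*-identityʳ ½ ⟩
  ½           ≤⟨ ½≤1 ⟩
  1ℚ          ∎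
  where open ℚ.≤-Reasoning

half^-antitone : ∀ {a b} → a ℕ.≤ b → half^ b ≤ half^ a
half^-antitone {a} a≤b with ℕ.m≤n⇒∃[o]m+o≡n a≤b
... | c , refl = begin
  half^ (a ℕ.+ c)    ≡⟨ half^-+ a c ⟩
  half^ a * half^ c  ≤⟨ *-monoˡ-≤ (half^-nonneg a) (half^-≤-1 c) ⟩
  half^ a * 1ℚ       ≡⟨ ℚ.*-identityʳ (half^ a) ⟩
  half^ a            ∎
  where open ℚ.≤-Reasoning

half^-double : ∀ p → half^ p ≡ half^ (suc p) + half^ (suc p)
half^-double p = begin
  half^ p                   ≡⟨ ℚ.*-identityˡ (half^ p) ⟨
  (½ + ½) * half^ p         ≡⟨ ℚ.*-distribʳ-+ (half^ p) ½ ½ ⟩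
  ½ * half^ p + ½ * half^ p ∎
  where open ≡-Reasoning

half^-pair-≤ : ∀ p {x x′ y y′} → x′ ≤ 0ℚ → half^ (suc p) * x ≤ y → y′ ≡ y → half^ p * (x + x′) ≤ y + y′
half^-pair-≤ p {x} {x′} {y} x′≤0 hx≤y refl = begin
  half^ p * (x + x′)                  ≡⟨ ℚ.*-distribˡ-+ (half^ p) x x′ ⟩
  half^ p * x + half^ p * x′          ≤⟨ ℚ.+-monoʳ-≤ (half^ p * x) (*-monoˡ-≤ (half^-nonneg p) x′≤0) ⟩
  half^ p * x + half^ p * 0ℚ          ≡⟨ cong (half^ p * x +_) (ℚ.*-zeroʳ (half^ p)) ⟩
  half^ p * x + 0ℚ                    ≡⟨ ℚ.+-identityʳ (half^ p * x) ⟩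
  half^ p * x                         ≡⟨ cong (_* x) (half^-double p) ⟩
  (h + h) * x                         ≡⟨ ℚ.*-distribʳ-+ x h h ⟩
  h * x + h * x                       ≤⟨ ℚ.+-mono-≤ hx≤y hx≤y ⟩
  y + y                               ∎
  where
  open ℚ.≤-Reasoning
  h = half^ (suc p)

half^-pair-≤′ : ∀ p {x x′ y y′} → x ≤ 0ℚ → half^ (suc p) * x′ ≤ y′ → y ≡ y′ → half^ p * (x + x′) ≤ y + y′
half^-pair-≤′ p {x} {x′} {y} {y′} x≤0 hx′≤y′ y≡y′ =
  subst₂ _≤_ (cong (half^ p *_) (ℚ.+-comm x′ x)) (ℚ.+-comm y′ y) (half^-pair-≤ p x≤0 hx′≤y′ y≡y′)

allVecs-complete : ∀ {m} (v : Vec₂ m) → v ∈ allVecs m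
allVecs-complete V.[]                 = here refl
allVecs-complete {suc m} (false V.∷ v) = ∈-++⁺ˡ (∈-map⁺ (false V.∷_) (allVecs-complete v))
allVecs-complete {suc m} (true V.∷ v)  =
  ∈-++⁺ʳ (map (false V.∷_) (allVecs m)) (∈-map⁺ (true V.∷_) (allVecs-complete v))

spanList-snoc : ∀ {m} (us : List (Vec₂ m)) c {v} → v ∈ spanList us → v ∈ spanList (us ++ [ c ])
spanList-snoc []       c (here refl) = here refl
spanList-snoc (u ∷ us) c v∈ with ∈-++⁻ (spanList us) v∈
... | inj₁ v∈us = ∈-++⁺ˡ (spanList-snoc us c v∈us)
... | inj₂ v∈u+us with ∈-map⁻ (u ⊕_) v∈u+us
...   | w , w∈us , refl = ∈-++⁺ʳ (spanList (us ++ [ c ])) (∈-map⁺ (u ⊕_) (spanList-snoc us c w∈us))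

inSpan-snoc : ∀ {m} {v : Vec₂ m} us c → inSpan v us ≡ true → inSpan v (us ++ [ c ]) ≡ true
inSpan-snoc {v = v} us c v∈ = memb⁺ (spanList-snoc us c (memb⁻ {x = v} v∈))

module Process {k : ℕ} (𝔽 : F2kField k) (d : ℕ) where
  open Construction 𝔽 d

  Column : Set
  Column = Vec₂ (d ℕ.* k)

  candidates : F → State → List Column
  candidates i s = filterᵇ (λ c → not (inSpan c (colsOf s))) (EvalBarCols i)

  extensions : State → List Column → List State
  extensions s = L.concatMap (λ c → (s ++ [ (c , false) ]) ∷ (s ++ [ (c , true) ]) ∷ [])

  stepFrom : State → List Column → List State
  stepFrom s []       = [ s ]
  stepFrom s (c ∷ cs) = extensions s (c ∷ cs)

  step≡stepFrom : ∀ i s → step i s ≡ stepFrom s (candidates i s)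
  step≡stepFrom i s with candidates i s
  ... | []    = refl
  ... | _ ∷ _ = refl

  step-snoc : ∀ i s {s′} → s′ ∈ step i s → s′ ≡ s ⊎ ∃[ x ] s′ ≡ s ++ [ x ]
  step-snoc i s s′∈ rewrite step≡stepFrom i s = from (candidates i s) s′∈
    where
    from : ∀ cs {s′} → s′ ∈ stepFrom s cs → s′ ≡ s ⊎ ∃[ x ] s′ ≡ s ++ [ x ]
    from []                (here refl)         = inj₁ refl
    from (c ∷ cs)          (here refl)         = inj₂ (_ , refl)
    from (c ∷ cs)          (there (here refl)) = inj₂ (_ , refl)
    from (c ∷ [])          (there (there ()))
    from (c ∷ cs@(_ ∷ _)) (there (there s′∈)) = from cs s′∈

  step-invariant : ∀ {P : State → Set} → (∀ s x → P s → P (s ++ [ x ])) → ∀ i → Invariant P (step i)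
  step-invariant P-snoc i {s} Ps s′∈ with step-snoc i s s′∈
  ... | inj₁ refl       = Ps
  ... | inj₂ (x , refl) = P-snoc s x Ps

  steps-all : ∀ {P : (State → List State) → Set} → (∀ i → P (step i)) → ∀ order e → All P (steps order e)
  steps-all P-step order e = concat⁺ (map⁺ (All.universal (λ i → replicate⁺ e (P-step i)) order))

  compact-snoc : ∀ {i} s x → compact i s ≡ true → compact i (s ++ [ x ]) ≡ true
  compact-snoc {i} s x cpt = allᵇ-intro (λ col → inSpan col (colsOf (s ++ [ x ]))) (EvalCols i) λ {col} col∈ →
    subst (λ cs → inSpan col cs ≡ true) (sym (map-++ proj₁ s [ x ]))
          (inSpan-snoc {v = col} (colsOf s) (proj₁ x) (allᵇ-elim (λ col → inSpan col (colsOf s)) cpt col∈))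

  candidate-column : ∀ i s {c} → c ∈ candidates i s → ∃[ w ] c ≡ (Eval· i) w
  candidate-column i s c∈
    with ∈-map⁻ (Eval· i) (proj₁ (∈-filter⁻ (T? ∘ λ c → not (inSpan c (colsOf s))) {xs = EvalBarCols i} c∈))
  ... | w , _ , c≡ = w , c≡

  -- each column Eval_i e_b of Eval_i is the column of \overline{Eval_i} indexed by e_b
  no-candidates⇒compact : ∀ i s → candidates i s ≡ [] → compact i s ≡ true
  no-candidates⇒compact i s none = allᵇ-intro _ (EvalCols i) λ col∈ → in-span col∈
    where
    in-span : ∀ {col} → col ∈ EvalCols i → inSpan col (colsOf s) ≡ true
    in-span col∈ with ∈-map⁻ (λ b → (Eval· i) (unit b)) col∈
    ... | b , _ , refl with inSpan ((Eval· i) (unit b)) (colsOf s)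
                          | filterᵇ-≡[] _ none (∈-map⁺ (Eval· i) (allVecs-complete (unit b)))
    ...   | true  | _  = refl
    ...   | false | ()

  𝔼-stuck : ∀ i s → candidates i s ≡ [] → ∀ m f → 𝔼 (L.replicate m (step i)) f s ≡ f s
  𝔼-stuck i s none zero    f = refl
  𝔼-stuck i s none (suc m) f rewrite step≡stepFrom i s | none =
    trans average-[ _ ] (𝔼-stuck i s none m f)

  ColumnInvariant : (State → ℚ) → Set
  ColumnInvariant g = ∀ {s s′} → colsOf s ≡ colsOf s′ → g s ≡ g s′

  colsOf-snoc : ∀ {s s′} c b b′ → colsOf s ≡ colsOf s′ → colsOf (s ++ [ (c , b) ]) ≡ colsOf (s′ ++ [ (c , b′) ])
  colsOf-snoc {s} {s′} c b b′ eq = begin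
    colsOf (s ++ [ (c , b) ])    ≡⟨ map-++ proj₁ s _ ⟩
    colsOf s ++ [ c ]            ≡⟨ cong (_++ [ c ]) eq ⟩
    colsOf s′ ++ [ c ]           ≡⟨ map-++ proj₁ s′ _ ⟨
    colsOf (s′ ++ [ (c , b′) ])  ∎
    where open ≡-Reasoning

  PreservesColumnInvariance : (State → List State) → Set
  PreservesColumnInvariance st = ∀ {g} → ColumnInvariant g → ColumnInvariant (λ s → average (map g (st s)))

  step-preservesColumnInvariance : ∀ i → PreservesColumnInvariance (step i)
  step-preservesColumnInvariance i {g} g-ci {s} {s′} eq rewrite step≡stepFrom i s | step≡stepFrom i s′ =
    cong average (subst (λ cs → map g (stepFrom s (candidates i s)) ≡ map g (stepFrom s′ cs)) same-candidates
                        (map-stepFrom (candidates i s)))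
    where
    same-candidates : candidates i s ≡ candidates i s′
    same-candidates = cong (λ cs → filterᵇ (λ c → not (inSpan c cs)) (EvalBarCols i)) eq
    map-extensions : ∀ cs → map g (extensions s cs) ≡ map g (extensions s′ cs)
    map-extensions []       = refl
    map-extensions (c ∷ cs) = cong₂ _∷_ (g-ci (colsOf-snoc c false false eq))
                                (cong₂ _∷_ (g-ci (colsOf-snoc c true true eq)) (map-extensions cs))
    map-stepFrom : ∀ cs → map g (stepFrom s cs) ≡ map g (stepFrom s′ cs)
    map-stepFrom []       = cong [_] (g-ci eq)
    map-stepFrom (c ∷ cs) = map-extensions (c ∷ cs)

  𝔼-columnInvariant : ∀ {sts} → All PreservesColumnInvariance sts →
                      ∀ {g} → ColumnInvariant g → ColumnInvariant (𝔼 sts g)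
  𝔼-columnInvariant []             g-ci = g-ci
  𝔼-columnInvariant (pres ∷ press) g-ci = pres (𝔼-columnInvariant press g-ci)

  sum-extensions-≤ : ∀ {X Y : State → ℚ} r s cs →
    (∀ {c} → c ∈ cs → r * (X (s ++ [ (c , false) ]) + X (s ++ [ (c , true) ]))
                       ≤ Y (s ++ [ (c , false) ]) + Y (s ++ [ (c , true) ])) →
    r * sumℚ (map X (extensions s cs)) ≤ sumℚ (map Y (extensions s cs))
  sum-extensions-≤             r s []       _    = ℚ.≤-reflexive (ℚ.*-zeroʳ r)
  sum-extensions-≤ {X} {Y} r s (c ∷ cs) pair-≤ = begin
    r * (x₀ + (x₁ + Σx))       ≡⟨ cong (r *_) (ℚ.+-assoc x₀ x₁ Σx) ⟨
    r * ((x₀ + x₁) + Σx)       ≡⟨ ℚ.*-distribˡ-+ r (x₀ + x₁) Σx ⟩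
    r * (x₀ + x₁) + r * Σx     ≤⟨ ℚ.+-mono-≤ (pair-≤ (here refl)) (sum-extensions-≤ r s cs (pair-≤ ∘ there)) ⟩
    (y₀ + y₁) + Σy             ≡⟨ ℚ.+-assoc y₀ y₁ Σy ⟩
    y₀ + (y₁ + Σy)             ∎
    where
    open ℚ.≤-Reasoning
    x₀ = X (s ++ [ (c , false) ]); x₁ = X (s ++ [ (c , true) ]); Σx = sumℚ (map X (extensions s cs))
    y₀ = Y (s ++ [ (c , false) ]); y₁ = Y (s ++ [ (c , true) ]); Σy = sumℚ (map Y (extensions s cs))

module Survival {k : ℕ} (𝔽 : F2kField k) (d : ℕ) (mono : List (Vec₂ k × Vec₂ k)) where
  open Construction 𝔽 d
  open Evaluation 𝔽 d using (dot-⟦⟧-Eval)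
  open Process 𝔽 d

  -- A constraint (Eval_i w , b) fixes ⟨f(i) , w⟩ = b, so it can only be met by an f with f(i) = j
  -- for a variable x_{i,j} of the monomial if b = ⟨j , w⟩.
  consistentAt : Column × Bool → Vec₂ k × Vec₂ k → Vec₂ k → Bool
  consistentAt (c , b) (i , j) w = not (c =ᵇ (Eval· i) w) ∨ does (b ≟𝔹 dot j w)

  consistentWith : Column × Bool → Bool
  consistentWith x = allᵇ (λ ij → allᵇ (consistentAt x ij) (allVecs k)) mono

  consistent : State → Bool
  consistent = allᵇ consistentWith

  survivor-bit : ∀ {s i j w b} → survives mono s ≡ true → ((Eval· i) w , b) ∈ s → (i , j) ∈ mono → b ≡ dot j w
  survivor-bit {s} {i} {j} {w} {b} surv cb∈s ij∈mono
    with anyᵇ-witness _ allPolys (allᵇ-elim (notInS₀ s) surv ij∈mono)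
  ... | f , _ , sat∧f[i]=j with satisfies ⟦ f ⟧ s in sat | eval f i =ᵇ j in f[i]=j
  ... | true | true = begin
    b                        ≡⟨ witness (dot ⟦ f ⟧ ((Eval· i) w) ≟𝔹 b) (allᵇ-elim _ sat cb∈s) ⟨
    dot ⟦ f ⟧ ((Eval· i) w)  ≡⟨ dot-⟦⟧-Eval f i w ⟩
    dot (eval f i) w         ≡⟨ cong (λ v → dot v w) (witness (≡-dec _≟𝔹_ (eval f i) j) f[i]=j) ⟩
    dot j w                  ∎
    where open ≡-Reasoning

  survives⇒consistent : ∀ s → survives mono s ≡ true → consistent s ≡ true
  survives⇒consistent s surv =
    allᵇ-intro consistentWith s λ {x} x∈s →
    allᵇ-intro _ mono λ {ij} ij∈mono →
    allᵇ-intro _ (allVecs k) λ _ → consistent-entry x x∈s ij ij∈mono _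
    where
    consistent-entry : ∀ x → x ∈ s → ∀ ij → ij ∈ mono → ∀ w → consistentAt x ij w ≡ true
    consistent-entry (c , b) cb∈s (i , j) ij∈mono w with c =ᵇ (Eval· i) w in c=ᵇ
    ... | false = refl
    ... | true rewrite witness (≡-dec _≟𝔹_ c _) c=ᵇ = dec-true (b ≟𝔹 dot j w) (survivor-bit surv cb∈s ij∈mono)

  inconsistent-extension : ∀ {i j w b} s → (i , j) ∈ mono → b ≢ dot j w →
                           consistent (s ++ [ ((Eval· i) w , b) ]) ≡ false
  inconsistent-extension {i} {j} {w} {b} s ij∈mono b≢ rewrite allᵇ-++ consistentWith s [ ((Eval· i) w , b) ]
    with consistentWith ((Eval· i) w , b) in ok
  ... | false = ∧-zeroʳ (consistent s)
  ... | true  = contradiction (witness (b ≟𝔹 dot j w) forced) b≢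
    where
    forced : does (b ≟𝔹 dot j w) ≡ true
    forced = subst (λ e → not e ∨ does (b ≟𝔹 dot j w) ≡ true) (=ᵇ-refl ((Eval· i) w))
                   (allᵇ-elim _ (allᵇ-elim _ ok ij∈mono) (allVecs-complete w))

  inconsistent-snoc : ∀ s x → consistent s ≡ false → consistent (s ++ [ x ]) ≡ false
  inconsistent-snoc s x inc rewrite allᵇ-++ consistentWith s [ x ] | inc = refl

  rows : List F
  rows = L.deduplicate (≡-dec _≟𝔹_) (map proj₁ mono)

  -- stated on columns, so that not (compact i s) is nonCompactᶜ i (colsOf s) by definition
  nonCompactᶜ : F → List Column → Bool
  nonCompactᶜ i cs = not (allᵇ (λ col → inSpan col cs) (EvalCols i))

  #nonCompactIn : List F → List Column → ℕ
  #nonCompactIn R cs = length (filterᵇ (λ x → memb x R ∧ nonCompactᶜ x cs) rows)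

  #nonCompactIn-[] : ∀ cs → #nonCompactIn [] cs ≡ 0
  #nonCompactIn-[] cs = cong length (filterᵇ-false rows)
    where
    filterᵇ-false : ∀ xs → filterᵇ (λ _ → false) xs ≡ []
    filterᵇ-false []       = refl
    filterᵇ-false (_ ∷ xs) = filterᵇ-false xs

  #nonCompactIn-complete : ∀ R → (∀ x → memb x R ≡ true) → ∀ s → #nonCompactIn R (colsOf s) ≡ #nonCompactRows mono s
  #nonCompactIn-complete R all s =
    cong length (filterᵇ-cong rows λ {x} _ → cong (_∧ nonCompactᶜ x (colsOf s)) (all x))

  #nonCompactIn-∷-≤ : ∀ i R cs → #nonCompactIn (i ∷ R) cs ℕ.≤ suc (#nonCompactIn R cs)
  #nonCompactIn-∷-≤ i R cs = length-filterᵇ-≤-suc _ _ i (deduplicate-! (≡-dec _≟𝔹_) (map proj₁ mono)) same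
    where
    same : ∀ x → x ≢ i → (memb x (i ∷ R) ∧ nonCompactᶜ x cs) ≡ (memb x R ∧ nonCompactᶜ x cs)
    same x x≢i rewrite dec-false (≡-dec _≟𝔹_ x i) x≢i = refl

  #nonCompactIn-∷-irrelevant : ∀ i R cs → (nonCompactᶜ i cs ≡ true → memb i rows ≢ true) →
                               #nonCompactIn (i ∷ R) cs ≡ #nonCompactIn R cs
  #nonCompactIn-∷-irrelevant i R cs irrelevant = cong length (filterᵇ-cong rows same)
    where
    same : ∀ {x} → x ∈ rows → (memb x (i ∷ R) ∧ nonCompactᶜ x cs) ≡ (memb x R ∧ nonCompactᶜ x cs)
    same {x} x∈rows with x =ᵇ i in x=ᵇi
    ... | false = refl
    ... | true rewrite witness (≡-dec _≟𝔹_ x i) x=ᵇi with nonCompactᶜ i cs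
    ...   | false = sym (∧-zeroʳ (memb i R))
    ...   | true  = contradiction (memb⁺ x∈rows) (irrelevant refl)

  row-variable : ∀ {i} → memb i rows ≡ true → ∃[ j ] (i , j) ∈ mono
  row-variable i∈ᵇrows with ∈-map⁻ proj₁ (Any.deduplicate⁻ (≡-dec _≟𝔹_) (memb⁻ i∈ᵇrows))
  ... | (_ , j) , ij∈mono , refl = j , ij∈mono

  module Bound (e t : ℕ) where

    enough : State → Bool
    enough s = t ≤ᵇ #nonCompactRows mono s

    consistent∧enough : State → Bool
    consistent∧enough s = consistent s ∧ enough s

    weight : List F → State → ℚ
    weight R s = half^ (e ℕ.* #nonCompactIn R (colsOf s)) * 𝟙 (enough s)

    weight-columnInvariant : ∀ R → ColumnInvariant (weight R)
    weight-columnInvariant R = cong λ cs →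
      half^ (e ℕ.* #nonCompactIn R cs) * 𝟙 (t ≤ᵇ length (filterᵇ (λ i → nonCompactᶜ i cs) rows))

    weight-∷ : ∀ i R s → half^ e * weight R s ≤ weight (i ∷ R) s
    weight-∷ i R s = begin
      half^ e * (half^ (e ℕ.* n) * 𝟙 (enough s))  ≡⟨ ℚ.*-assoc (half^ e) _ _ ⟨
      half^ e * half^ (e ℕ.* n) * 𝟙 (enough s)    ≡⟨ cong (_* 𝟙 (enough s)) (half^-+ e (e ℕ.* n)) ⟨
      half^ (e ℕ.+ e ℕ.* n) * 𝟙 (enough s)        ≡⟨ cong (λ m → half^ m * 𝟙 (enough s)) (ℕ.*-suc e n) ⟨
      half^ (e ℕ.* suc n) * 𝟙 (enough s)
        ≤⟨ *-monoʳ-≤ (𝟙-nonneg _) (half^-antitone (ℕ.*-monoʳ-≤ e (#nonCompactIn-∷-≤ i R (colsOf s)))) ⟩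
      weight (i ∷ R) s                             ∎
      where
      open ℚ.≤-Reasoning
      n = #nonCompactIn R (colsOf s)

    weight-∷-irrelevant : ∀ i R s → (nonCompactᶜ i (colsOf s) ≡ true → memb i rows ≢ true) →
                          weight R s ≤ weight (i ∷ R) s
    weight-∷-irrelevant i R s irrelevant = ℚ.≤-reflexive
      (cong (λ n → half^ (e ℕ.* n) * 𝟙 (enough s)) (sym (#nonCompactIn-∷-irrelevant i R (colsOf s) irrelevant)))

    module Row (i j : F) (ij∈mono : (i , j) ∈ mono) {f g : State → ℚ}
               (f-nonneg : ∀ s → 0ℚ ≤ f s)
               (f-inconsistent : ∀ {s} → consistent s ≡ false → f s ≤ 0ℚ)
               (f≤g-compact : ∀ {s} → compact i s ≡ true → f s ≤ g s)
               (g-ci : ColumnInvariant g) where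

      rep : ℕ → List (State → List State)
      rep m = L.replicate m (step i)

      𝔼-inconsistent : ∀ m {s} → consistent s ≡ false → 𝔼 (rep m) f s ≤ 0ℚ
      𝔼-inconsistent m {s} inc = ℚ.≤-trans
        (𝔼-mono-on (λ s → consistent s ≡ false) (rep m) (replicate⁺ m (step-invariant inconsistent-snoc i))
                   {g = λ _ → 0ℚ} f-inconsistent inc)
        (ℚ.≤-reflexive (𝔼-0 (rep m) s))

      -- p halvings have been earned by the steps of row i taken so far, and m steps remain
      halving : ∀ m p → (∀ s → half^ (m ℕ.+ p) * f s ≤ g s) → ∀ s → half^ p * 𝔼 (rep m) f s ≤ 𝔼 (rep m) g s
      halving zero    p H s = H s
      halving (suc m) p H s rewrite step≡stepFrom i s with candidates i s in cands
      ... | [] = begin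
        half^ p * average [ 𝔼 (rep m) f s ]  ≡⟨ cong (half^ p *_) (trans average-[ _ ] (𝔼-stuck i s cands m f)) ⟩
        half^ p * f s                         ≤⟨ *-monoʳ-≤ (f-nonneg s) (half^-≤-1 p) ⟩
        1ℚ * f s                              ≡⟨ ℚ.*-identityˡ (f s) ⟩
        f s                                   ≤⟨ f≤g-compact (no-candidates⇒compact i s cands) ⟩
        g s                                   ≡⟨ trans average-[ _ ] (𝔼-stuck i s cands m g) ⟨
        average [ 𝔼 (rep m) g s ]             ∎
        where open ℚ.≤-Reasoning
      ... | c ∷ cs = average-≤ (extensions s (c ∷ cs)) {X} {Y} (half^ p) (half^-nonneg p)
                       (sum-extensions-≤ {X} {Y} (half^ p) s (c ∷ cs) λ c∈ → pair-≤ (subst (_ ∈_) (sym cands) c∈))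
        where
        X Y : State → ℚ
        X = 𝔼 (rep m) f
        Y = 𝔼 (rep m) g

        H′ : ∀ s → half^ (m ℕ.+ suc p) * f s ≤ g s
        H′ s = subst (λ n → half^ n * f s ≤ g s) (sym (ℕ.+-suc m p)) (H s)

        Y-ci : ColumnInvariant Y
        Y-ci = 𝔼-columnInvariant (replicate⁺ m (step-preservesColumnInvariance i)) g-ci

        pair-≤ : ∀ {c} → c ∈ candidates i s →
                 half^ p * (X (s ++ [ (c , false) ]) + X (s ++ [ (c , true) ]))
                   ≤ Y (s ++ [ (c , false) ]) + Y (s ++ [ (c , true) ])
        pair-≤ c∈ with candidate-column i s c∈
        ... | w , refl with dot j w in jw
        ... | false = half^-pair-≤ p
          (𝔼-inconsistent m (inconsistent-extension s ij∈mono λ t≡ → case trans t≡ jw of λ ()))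
          (halving m (suc p) H′ _) (Y-ci (colsOf-snoc _ true false refl))
        ... | true  = half^-pair-≤′ p
          (𝔼-inconsistent m (inconsistent-extension s ij∈mono λ f≡ → case trans f≡ jw of λ ()))
          (halving m (suc p) H′ _) (Y-ci (colsOf-snoc _ false true refl))

    𝔼-target-nonneg : ∀ R s → 0ℚ ≤ 𝔼 (steps R e) (𝟙 ∘ consistent∧enough) s
    𝔼-target-nonneg R = 𝔼-nonneg (steps R e) (λ _ → 𝟙-nonneg _)

    𝔼-target-inconsistent : ∀ R {s} → consistent s ≡ false → 𝔼 (steps R e) (𝟙 ∘ consistent∧enough) s ≤ 0ℚ
    𝔼-target-inconsistent R {s} inc = ℚ.≤-trans
      (𝔼-mono-on (λ s → consistent s ≡ false) (steps R e) (steps-all (step-invariant inconsistent-snoc) R e)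
                 {g = λ _ → 0ℚ} (λ {s} inc → ℚ.≤-reflexive (cong (λ b → 𝟙 (b ∧ enough s)) inc)) inc)
      (ℚ.≤-reflexive (𝔼-0 (steps R e) s))

    𝔼-weight-columnInvariant : ∀ R R′ → ColumnInvariant (𝔼 (steps R e) (weight R′))
    𝔼-weight-columnInvariant R R′ =
      𝔼-columnInvariant (steps-all step-preservesColumnInvariance R e) (weight-columnInvariant R′)

    𝔼-weight-∷ : ∀ i R s → half^ e * 𝔼 (steps R e) (weight R) s ≤ 𝔼 (steps R e) (weight (i ∷ R)) s
    𝔼-weight-∷ i R s = begin
      half^ e * 𝔼 (steps R e) (weight R) s          ≡⟨ 𝔼-*ˡ (steps R e) (weight R) (half^ e) s ⟨
      𝔼 (steps R e) (λ s → half^ e * weight R s) s  ≤⟨ 𝔼-mono (steps R e) (weight-∷ i R) s ⟩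
      𝔼 (steps R e) (weight (i ∷ R)) s              ∎
      where open ℚ.≤-Reasoning

    𝔼-weight-∷-compact : ∀ i R {s} → compact i s ≡ true →
                         𝔼 (steps R e) (weight R) s ≤ 𝔼 (steps R e) (weight (i ∷ R)) s
    𝔼-weight-∷-compact i R =
      𝔼-mono-on (λ s → compact i s ≡ true) (steps R e) (steps-all (step-invariant compact-snoc) R e)
                (λ {s} cpt → weight-∷-irrelevant i R s λ nc _ → case trans (sym nc) (cong not cpt) of λ ())

    -- Induction over the rows from the last one: after the rows R have run, the weight accounts for
    -- e halvings per monomial row of R that is non-compact at the end.
    bound : ∀ R s → 𝔼 (steps R e) (𝟙 ∘ consistent∧enough) s ≤ 𝔼 (steps R e) (weight R) s
    bound [] s = begin
      𝟙 (consistent s ∧ enough s)     ≤⟨ 𝟙-mono (∧-conicalʳ (consistent s) (enough s)) ⟩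
      𝟙 (enough s)                    ≡⟨ ℚ.*-identityˡ (𝟙 (enough s)) ⟨
      half^ 0 * 𝟙 (enough s)          ≡⟨ cong (λ n → half^ n * 𝟙 (enough s)) (ℕ.*-zeroʳ e) ⟨
      half^ (e ℕ.* 0) * 𝟙 (enough s)  ≡⟨ cong (λ n → half^ (e ℕ.* n) * 𝟙 (enough s)) (#nonCompactIn-[] (colsOf s)) ⟨
      weight [] s                     ∎
      where open ℚ.≤-Reasoning
    bound (i ∷ R) s = begin
      𝔼 (rep ++ steps R e) (𝟙 ∘ consistent∧enough) s  ≡⟨ 𝔼-++ rep (steps R e) _ s ⟩
      𝔼 rep f s                                        ≤⟨ row-bound (memb i rows) refl ⟩
      𝔼 rep g s                                        ≡⟨ 𝔼-++ rep (steps R e) _ s ⟨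
      𝔼 (rep ++ steps R e) (weight (i ∷ R)) s          ∎
      where
      open ℚ.≤-Reasoning
      rep = L.replicate e (step i)
      f g : State → ℚ
      f = 𝔼 (steps R e) (𝟙 ∘ consistent∧enough)
      g = 𝔼 (steps R e) (weight (i ∷ R))

      other-row : memb i rows ≡ false → 𝔼 rep f s ≤ 𝔼 rep g s
      other-row ∉rows = 𝔼-mono rep (λ s → ℚ.≤-trans (bound R s)
        (𝔼-mono (steps R e) (λ s → weight-∷-irrelevant i R s λ _ ∈rows → case trans (sym ∉rows) ∈rows of λ ()) s)) s

      new-row : ∀ j → (i , j) ∈ mono → 𝔼 rep f s ≤ 𝔼 rep g s
      new-row j ij∈mono = ℚ.≤-trans (ℚ.≤-reflexive (sym (ℚ.*-identityˡ (𝔼 rep f s))))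
        (Row.halving i j ij∈mono (𝔼-target-nonneg R) (𝔼-target-inconsistent R)
           (λ cpt → ℚ.≤-trans (bound R _) (𝔼-weight-∷-compact i R cpt)) (𝔼-weight-columnInvariant R (i ∷ R))
           e 0 halved s)
        where
        halved : ∀ s → half^ (e ℕ.+ 0) * f s ≤ g s
        halved s rewrite ℕ.+-identityʳ e =
          ℚ.≤-trans (*-monoˡ-≤ (half^-nonneg e) (bound R s)) (𝔼-weight-∷ i R s)

      row-bound : ∀ b → memb i rows ≡ b → 𝔼 rep f s ≤ 𝔼 rep g s
      row-bound false ∉rows = other-row ∉rows
      row-bound true  ∈rows = let j , ij∈mono = row-variable ∈rows in new-row j ij∈mono

    weight-complete-≤ : ∀ order → (∀ x → memb x order ≡ true) → ∀ s → weight order s ≤ half^ (e ℕ.* t) * 𝟙 (enough s)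
    weight-complete-≤ order all s with enough s in t≤ᵇ
    ... | false = ℚ.≤-reflexive (trans (ℚ.*-zeroʳ (half^ (e ℕ.* #nonCompactIn order (colsOf s))))
                                       (sym (ℚ.*-zeroʳ (half^ (e ℕ.* t)))))
    ... | true  = *-monoʳ-≤ 0≤1 (half^-antitone (ℕ.*-monoʳ-≤ e t≤#))
      where
      t≤# : t ℕ.≤ #nonCompactIn order (colsOf s)
      t≤# = subst (t ℕ.≤_) (sym (#nonCompactIn-complete order all s))
                  (ℕ.≤ᵇ⇒≤ t (#nonCompactRows mono s) (subst T (sym t≤ᵇ) tt))

    survival-bound : ∀ order → (∀ x → memb x order ≡ true) →
      prob (steps order e) (λ s → survives mono s ∧ enough s) [] ≤ half^ (e ℕ.* t) * prob (steps order e) enough []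
    survival-bound order all = begin
      prob sts (λ s → survives mono s ∧ enough s) []   ≡⟨ prob≡𝔼 sts _ [] ⟩
      𝔼 sts (λ s → 𝟙 (survives mono s ∧ enough s)) []  ≤⟨ 𝔼-mono sts (λ s → 𝟙-mono (survives⇒consistent∧ s)) [] ⟩
      𝔼 sts (𝟙 ∘ consistent∧enough) []                 ≤⟨ bound order [] ⟩
      𝔼 sts (weight order) []                          ≤⟨ 𝔼-mono sts (weight-complete-≤ order all) [] ⟩
      𝔼 sts (λ s → half^ (e ℕ.* t) * 𝟙 (enough s)) []  ≡⟨ 𝔼-*ˡ sts (𝟙 ∘ enough) (half^ (e ℕ.* t)) [] ⟩
      half^ (e ℕ.* t) * 𝔼 sts (𝟙 ∘ enough) []          ≡⟨ cong (half^ (e ℕ.* t) *_) (prob≡𝔼 sts enough []) ⟨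
      half^ (e ℕ.* t) * prob sts enough []             ∎
      where
      open ℚ.≤-Reasoning
      sts = steps order e
      survives⇒consistent∧ : ∀ s → (survives mono s ∧ enough s) ≡ true → consistent∧enough s ≡ true
      survives⇒consistent∧ s surv∧ = cong₂ _∧_ (survives⇒consistent s (∧-conicalˡ (survives mono s) (enough s) surv∧))
                                               (∧-conicalʳ (survives mono s) (enough s) surv∧)

lemma5p10 : (k d e t : ℕ) (𝔽 : F2kField k) (enum : Fin (2 ^ k) ↔ Vec₂ k)
  (mono : List (Vec₂ k × Vec₂ k)) → t < d ∸ 1 →
  let open Construction 𝔽 d
      order = map (Inverse.to enum) (allFin (2 ^ k))
  in prob (steps order e) (λ s → survives mono s ∧ (t ≤ᵇ #nonCompactRows mono s)) []
       ≤ half^ (e ℕ.* t) Data.Rational.* prob (steps order e) (λ s → t ≤ᵇ #nonCompactRows mono s) []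
lemma5p10 k d e t 𝔽 enum mono _ =
  Survival.Bound.survival-bound 𝔽 d mono e t order (λ x → memb⁺ (enumerated x))
  where
  order = map (Inverse.to enum) (allFin (2 ^ k))
  enumerated : ∀ x → x ∈ order
  enumerated x = subst (_∈ order) (Inverse.strictlyInverseˡ enum x)
                       (∈-map⁺ (Inverse.to enum) (∈-allFin (Inverse.from enum x)))
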